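{- If $G$ is a finite directed acyclic graph, then $\mathrm{DT}(G)$ is shellable.
   Context: A directed acyclic graph is a directed graph without directed cycles. A directed forest in a directed graph $G$ is a set $F$ of edges of $G$ such that at most one edge of $F$ is directed to each vertex and $F$ contains no directed cycle. $\mathrm{DT}(G)$ is the simplicial complex with vertex set $E(G)$ whose faces are the edge sets of directed forests of $G$. A simplicial complex is shellable if its maximal faces can be ordered $F_1,\ldots,F_n$ so that for all $1\le i<k\le n$ there are $1\le j<k$ and $e\in F_k$ with $F_i\cap F_k\subseteq F_j\cap F_k=F_k\setminus\{e\}$. -}

module Defs where

open import Data.Nat using (ℕ; suc)
open import Data.Fin using (Fin; _<_; suc; zero)
open import Data.Fin.Subset using (Subset; ⊤; _∈_; _⊆_; _⊂_; _∩_; _-_)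
open import Data.List using (List; []; _∷_)
open import Data.Product using (Σ; ∃; ∃-syntax; _×_; _,_)
open import Relation.Binary.PropositionalEquality using (_≡_)
open import Relation.Nullary using (¬_)
open import Function.Definitions using (Injective)

-- A finite directed graph (loops and parallel edges allowed a priori):
-- vertices Fin n, edges Fin m, each edge e goes from src e to tgt e.
record Digraph : Set where
  field
    n   : ℕ
    m   : ℕ
    src : Fin m → Fin n
    tgt : Fin m → Fin n

open Digraph public

data Walk (G : Digraph) (S : Subset (m G)) : Fin (m G) → Fin (m G) → Set where
  single : ∀ {e} → e ∈ S → Walk G S e e
  step   : ∀ {e f e'} → e ∈ S → tgt G e ≡ src G f → Walk G S f e' → Walk G S e e'

HasDirectedCycle : (G : Digraph) → Subset (m G) → Set
HasDirectedCycle G S = ∃[ e ] ∃[ e' ] (Walk G S e e' × tgt G e' ≡ src G e)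

AllEdges : (G : Digraph) → Subset (m G)
AllEdges G = ⊤

IsDAG : Digraph → Set
IsDAG G = ¬ HasDirectedCycle G (AllEdges G)

IsDirectedForest : (G : Digraph) → Subset (m G) → Set
IsDirectedForest G F =
  (∀ e f → e ∈ F → f ∈ F → tgt G e ≡ tgt G f → e ≡ f) × ¬ HasDirectedCycle G F

-- Faces of DT(G) are the directed forests; facets are the maximal faces.
IsFacetDT : (G : Digraph) → Subset (m G) → Set
IsFacetDT G F = IsDirectedForest G F × (∀ F' → IsDirectedForest G F' → ¬ (F ⊂ F'))

IsShellingDT : (G : Digraph) (N : ℕ) → (Fin N → Subset (m G)) → Set
IsShellingDT G N F =
  Injective _≡_ _≡_ F
  × (∀ i → IsFacetDT G (F i))
  × (∀ X → IsFacetDT G X → ∃[ i ] F i ≡ X)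
  × (∀ i k → i < k →
       ∃[ j ] ∃[ e ] (j < k × e ∈ F k
         × (F i ∩ F k) ⊆ (F j ∩ F k)
         × (F j ∩ F k) ≡ (F k - e)))

DTShellable : Digraph → Set
DTShellable G = ∃[ N ] ∃[ F ] IsShellingDT G N F

{-# OPTIONS --safe #-}
module Submission where

-- In a DAG every set of edges is acyclic, so a directed forest is just a set of edges with
-- distinct heads, and the facets of DT(G) are the transversals of the fibres of tgt: one
-- incoming edge at every vertex that has one.  Listing them in lexicographic order is a
-- shelling.  If F_i comes before F_k, let p be the first edge on which they differ
-- (p ∈ F_k, p ∉ F_i) and g the edge of F_i with the same head as p; replacing p by g in F_k
-- gives a facet F_j before F_k with F_i ∩ F_k ⊆ F_j ∩ F_k = F_k ∖ {p}.

open import Defs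

open import Data.Bool.Base using (true; false; f<t) renaming (_<_ to _<ᵇ_)
import Data.Bool.Properties as Bool
open import Data.Fin.Base using (Fin; zero; suc; _<_)
open import Data.Fin.Properties using (_≟_; all?; any?; <-cmp; <-irrefl; <-asym)
open import Data.Fin.Subset using (Subset; _∈_; _∉_; _⊆_; _⊂_; _∩_; _∪_; _-_; ⁅_⁆)
open import Data.Fin.Subset.Properties
  using ( _∈?_; ∈⊤; drop-there; p⊆p∪q; p─q⊆p; ⊆-antisym; x∈p∩q⁺; x∈p∩q⁻; x∈p∪q⁺; x∈p∪q⁻
        ; x∈⁅x⁆; x∈⁅y⁆⇒x≡y; x∈p∧x≢y⇒x∈p-y)
open import Data.List.Base using (List; [_]; _++_; map; filter; length; lookup)
open import Data.List.Membership.Propositional using () renaming (_∈_ to _∈ˡ_)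
open import Data.List.Membership.Propositional.Properties
  using (∈-filter⁺; ∈-filter⁻; ∈-map⁺; ∈-++⁺ˡ; ∈-++⁺ʳ; ∈-lookup)
import Data.List.Relation.Unary.All as All
import Data.List.Relation.Unary.All.Properties as All
open import Data.List.Relation.Unary.AllPairs as AllPairs using (AllPairs; []; _∷_)
import Data.List.Relation.Unary.AllPairs.Properties as AllPairs
open import Data.List.Relation.Unary.Any using (here; index)
open import Data.List.Relation.Unary.Any.Properties using (lookup-index)
open import Data.Nat.Base using (ℕ; zero; suc; z<s; s<s)
open import Data.Product using (∃-syntax; _×_; _,_; proj₂)
open import Data.Sum using (_⊎_; inj₁; inj₂)
open import Data.Vec.Base using ([]; _∷_; here; there)
open import Data.Vec.Relation.Binary.Lex.Strict using (Lex-<; this; next) renaming (<-asym to Lex-<-asym)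
open import Function.Bundles using (_⇔_; mk⇔; Equivalence)
open import Function.Definitions using (Injective)
open import Relation.Binary.Definitions using (Asymmetric; tri<; tri≈; tri>)
open import Relation.Binary.PropositionalEquality using (_≡_; _≢_; refl; sym; trans; subst)
open import Relation.Nullary using (¬_; Dec; yes; no; contradiction)
open import Relation.Nullary.Decidable using (_×-dec_; _→-dec_)

open Equivalence using (to; from)

_<ₗₑₓ_ : ∀ {k} → Subset k → Subset k → Set
_<ₗₑₓ_ = Lex-< _≡_ _<ᵇ_

<ₗₑₓ-asym : ∀ {k} → Asymmetric (_<ₗₑₓ_ {k})
<ₗₑₓ-asym = Lex-<-asym sym Bool.<-resp₂-≡ Bool.<-asym

AgreeBelow : ∀ {k} → Fin k → Subset k → Subset k → Set
AgreeBelow p A B = ∀ {q} → q < p → q ∈ A ⇔ q ∈ B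

FirstDifferenceAt : ∀ {k} → Fin k → Subset k → Subset k → Set
FirstDifferenceAt p A B = p ∉ A × p ∈ B × AgreeBelow p A B

agreeBelow-∷ : ∀ {k b} {p : Fin k} {A B} → AgreeBelow p A B → AgreeBelow (suc p) (b ∷ A) (b ∷ B)
agreeBelow-∷ agree {zero}  _          = mk⇔ (λ { here → here }) (λ { here → here })
agreeBelow-∷ agree {suc q} (s<s q<p) =
  mk⇔ (λ q∈A → there (to (agree q<p) (drop-there q∈A)))
      (λ q∈B → there (from (agree q<p) (drop-there q∈B)))

agreeBelow-tail : ∀ {k a b} {p : Fin k} {A B} → AgreeBelow (suc p) (a ∷ A) (b ∷ B) → AgreeBelow p A B
agreeBelow-tail agree q<p =
  mk⇔ (λ q∈A → drop-there (to (agree (s<s q<p)) (there q∈A)))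
      (λ q∈B → drop-there (from (agree (s<s q<p)) (there q∈B)))

agreeBelow-head : ∀ {k a b} {p : Fin k} {A B} → AgreeBelow (suc p) (a ∷ A) (b ∷ B) → a ≡ b
agreeBelow-head {a = false} {false} agree = refl
agreeBelow-head {a = true}  {true}  agree = refl
agreeBelow-head {a = true}  {false} agree with to   (agree z<s) here
... | ()
agreeBelow-head {a = false} {true}  agree with from (agree z<s) here
... | ()

<ₗₑₓ⇒firstDifference : ∀ {k} {A B : Subset k} → A <ₗₑₓ B → ∃[ p ] FirstDifferenceAt p A B
<ₗₑₓ⇒firstDifference (this f<t refl) = zero , (λ ()) , here , λ ()
<ₗₑₓ⇒firstDifference (next refl A<B) with <ₗₑₓ⇒firstDifference A<B
... | p , p∉A , p∈B , agree = suc p , (λ p∈A → p∉A (drop-there p∈A)) , there p∈B , agreeBelow-∷ agree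

firstDifference⇒<ₗₑₓ : ∀ {k} {p : Fin k} {A B} → FirstDifferenceAt p A B → A <ₗₑₓ B
firstDifference⇒<ₗₑₓ {p = zero} {true ∷ A} (p∉A , _ , _) = contradiction here p∉A
firstDifference⇒<ₗₑₓ {p = zero} {false ∷ A} (_ , here , _) = this f<t refl
firstDifference⇒<ₗₑₓ {p = suc p} {a ∷ A} {b ∷ B} (p∉A , p∈B , agree) with agreeBelow-head agree
... | refl = next refl (firstDifference⇒<ₗₑₓ ((λ p∈A → p∉A (there p∈A)) , drop-there p∈B , agreeBelow-tail agree))

subsets : ∀ k → List (Subset k)
subsets zero    = [ [] ]
subsets (suc k) = map (false ∷_) (subsets k) ++ map (true ∷_) (subsets k)

∈-subsets : ∀ {k} (A : Subset k) → A ∈ˡ subsets k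
∈-subsets []          = here refl
∈-subsets (false ∷ A) = ∈-++⁺ˡ (∈-map⁺ (false ∷_) (∈-subsets A))
∈-subsets (true ∷ A)  = ∈-++⁺ʳ (map (false ∷_) (subsets _)) (∈-map⁺ (true ∷_) (∈-subsets A))

subsets-sorted : ∀ k → AllPairs _<ₗₑₓ_ (subsets k)
subsets-sorted zero    = All.[] ∷ []
subsets-sorted (suc k) =
  AllPairs.++⁺ (prefixed (subsets-sorted k)) (prefixed (subsets-sorted k))
    (All.map⁺ (All.universal (λ _ → All.map⁺ (All.universal (λ _ → this f<t refl) (subsets k))) (subsets k)))
  where
  prefixed : ∀ {b} {As : List (Subset k)} → AllPairs _<ₗₑₓ_ As → AllPairs _<ₗₑₓ_ (map (b ∷_) As)
  prefixed sorted = AllPairs.map⁺ (AllPairs.map (next refl) sorted)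

lookup-strictMono : ∀ {A : Set} {R : A → A → Set} {xs : List A} → AllPairs R xs →
                    ∀ {i j} → i < j → R (lookup xs i) (lookup xs j)
lookup-strictMono (x≺xs ∷ _)      {zero}  {suc j} _         = All.lookup x≺xs (∈-lookup j)
lookup-strictMono (_    ∷ sorted) {suc i} {suc j} (s<s i<j) = lookup-strictMono sorted i<j

module _ {A : Set} {R : A → A → Set} {xs : List A} (sorted : AllPairs R xs) (asym : Asymmetric R) where

  lookup-injective : Injective _≡_ _≡_ (lookup xs)
  lookup-injective {i} {j} eq with <-cmp i j
  ... | tri< i<j _ _ = contradiction (subst (R _) (sym eq) (lookup-strictMono sorted i<j)) (λ r → asym r r)
  ... | tri≈ _ i≡j _ = i≡j
  ... | tri> _ _ j<i = contradiction (subst (R _) eq (lookup-strictMono sorted j<i)) (λ r → asym r r)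

  lookup-reflects : ∀ {i j} → R (lookup xs i) (lookup xs j) → i < j
  lookup-reflects {i} {j} r with <-cmp i j
  ... | tri< i<j _ _  = i<j
  ... | tri≈ _ refl _ = contradiction r (asym r)
  ... | tri> _ _ j<i  = contradiction (lookup-strictMono sorted j<i) (asym r)

x∉p-x : ∀ {k} (A : Subset k) x → x ∉ A - x
x∉p-x (true ∷ A)  zero    ()
x∉p-x (false ∷ A) zero    ()
x∉p-x (_ ∷ A)     (suc x) x∈A-x = x∉p-x A x (drop-there x∈A-x)

x∈p-y⇒x≢y : ∀ {k} {A : Subset k} {x y} → x ∈ A - y → x ≢ y
x∈p-y⇒x≢y {A = A} x∈A-y refl = x∉p-x A _ x∈A-y

x∈p∪⁅y⁆⁻ : ∀ {k} {A : Subset k} {x y} → x ∈ A ∪ ⁅ y ⁆ → x ∈ A ⊎ x ≡ y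
x∈p∪⁅y⁆⁻ {A = A} {y = y} x∈A∪y with x∈p∪q⁻ A ⁅ y ⁆ x∈A∪y
... | inj₁ x∈A   = inj₁ x∈A
... | inj₂ x∈⁅y⁆ = inj₂ (x∈⁅y⁆⇒x≡y y x∈⁅y⁆)

swap : ∀ {k} → Subset k → Fin k → Fin k → Subset k
swap B p g = (B - p) ∪ ⁅ g ⁆

module _ {k} {B : Subset k} {p g : Fin k} where

  ∈-swap⁺ : ∀ {x} → x ∈ B → x ≢ p → x ∈ swap B p g
  ∈-swap⁺ x∈B x≢p = x∈p∪q⁺ (inj₁ (x∈p∧x≢y⇒x∈p-y x∈B x≢p))

  ∈-swap-new : g ∈ swap B p g
  ∈-swap-new = x∈p∪q⁺ (inj₂ (x∈⁅x⁆ g))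

  ∈-swap⁻ : ∀ {x} → x ∈ swap B p g → (x ∈ B × x ≢ p) ⊎ x ≡ g
  ∈-swap⁻ x∈C with x∈p∪⁅y⁆⁻ x∈C
  ... | inj₁ x∈B-p = inj₁ (p─q⊆p B ⁅ p ⁆ x∈B-p , x∈p-y⇒x≢y x∈B-p)
  ... | inj₂ x≡g   = inj₂ x≡g

  swap-<ₗₑₓ : p ∈ B → p < g → swap B p g <ₗₑₓ B
  swap-<ₗₑₓ p∈B p<g = firstDifference⇒<ₗₑₓ (p∉swap , p∈B , agree)
    where
    p∉swap : p ∉ swap B p g
    p∉swap p∈C with ∈-swap⁻ p∈C
    ... | inj₁ (_ , p≢p) = p≢p refl
    ... | inj₂ refl      = <-irrefl refl p<g
    agree : AgreeBelow p (swap B p g) B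
    agree q<p = mk⇔ q∈C⇒q∈B (λ q∈B → ∈-swap⁺ q∈B (λ { refl → <-irrefl refl q<p }))
      where
      q∈C⇒q∈B : _ ∈ swap B p g → _ ∈ B
      q∈C⇒q∈B q∈C with ∈-swap⁻ q∈C
      ... | inj₁ (q∈B , _) = q∈B
      ... | inj₂ refl      = contradiction p<g (<-asym q<p)

  swap-∩-⊇ : ∀ {A} → p ∉ A → A ∩ B ⊆ swap B p g ∩ B
  swap-∩-⊇ p∉A x∈A∩B with x∈p∩q⁻ _ B x∈A∩B
  ... | x∈A , x∈B = x∈p∩q⁺ (∈-swap⁺ x∈B (λ { refl → p∉A x∈A }) , x∈B)

  swap-∩ : g ∉ B → swap B p g ∩ B ≡ B - p
  swap-∩ g∉B = ⊆-antisym C∩B⊆B-p B-p⊆C∩B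
    where
    C∩B⊆B-p : swap B p g ∩ B ⊆ B - p
    C∩B⊆B-p x∈C∩B with x∈p∩q⁻ (swap B p g) B x∈C∩B
    ... | x∈C , x∈B with ∈-swap⁻ x∈C
    ...   | inj₁ (_ , x≢p) = x∈p∧x≢y⇒x∈p-y x∈B x≢p
    ...   | inj₂ refl      = contradiction x∈B g∉B
    B-p⊆C∩B : B - p ⊆ swap B p g ∩ B
    B-p⊆C∩B x∈B-p = x∈p∩q⁺ (∈-swap⁺ x∈B (x∈p-y⇒x≢y x∈B-p) , x∈B)
      where x∈B = p─q⊆p B ⁅ p ⁆ x∈B-p

module Transversals {m n : ℕ} (t : Fin m → Fin n) where

  InjectiveOn : Subset m → Set
  InjectiveOn S = ∀ e f → e ∈ S → f ∈ S → t e ≡ t f → e ≡ f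

  MeetsFibre : Subset m → Fin m → Set
  MeetsFibre S e = ∃[ f ] (f ∈ S × t f ≡ t e)

  IsTransversal : Subset m → Set
  IsTransversal S = InjectiveOn S × (∀ e → MeetsFibre S e)

  meetsFibre? : ∀ S e → Dec (MeetsFibre S e)
  meetsFibre? S e = any? λ f → (f ∈? S) ×-dec (t f ≟ t e)

  isTransversal? : ∀ S → Dec (IsTransversal S)
  isTransversal? S =
    all? (λ e → all? λ f → (e ∈? S) →-dec (f ∈? S) →-dec (t e ≟ t f) →-dec (e ≟ f))
    ×-dec all? (meetsFibre? S)

  injectiveOn-∪-⁅⁆ : ∀ {S e} → InjectiveOn S → ¬ MeetsFibre S e → InjectiveOn (S ∪ ⁅ e ⁆)
  injectiveOn-∪-⁅⁆ inj ¬meets x y x∈ y∈ tx≡ty with x∈p∪⁅y⁆⁻ x∈ | x∈p∪⁅y⁆⁻ y∈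
  ... | inj₁ x∈S | inj₁ y∈S = inj x y x∈S y∈S tx≡ty
  ... | inj₁ x∈S | inj₂ refl = contradiction (x , x∈S , tx≡ty) ¬meets
  ... | inj₂ refl | inj₁ y∈S = contradiction (y , y∈S , sym tx≡ty) ¬meets
  ... | inj₂ refl | inj₂ refl = refl

  swap-isTransversal : ∀ {B p g} → IsTransversal B → p ∈ B → t g ≡ t p → IsTransversal (swap B p g)
  swap-isTransversal {B} {p} {g} (inj , meets) p∈B tg≡tp = injC , meetsC
    where
    injC : InjectiveOn (swap B p g)
    injC x y x∈C y∈C tx≡ty with ∈-swap⁻ x∈C | ∈-swap⁻ y∈C
    ... | inj₁ (x∈B , _)   | inj₁ (y∈B , _)   = inj x y x∈B y∈B tx≡ty
    ... | inj₁ (x∈B , x≢p) | inj₂ refl        = contradiction (inj x p x∈B p∈B (trans tx≡ty tg≡tp)) x≢p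
    ... | inj₂ refl        | inj₁ (y∈B , y≢p) = contradiction (inj y p y∈B p∈B (trans (sym tx≡ty) tg≡tp)) y≢p
    ... | inj₂ refl        | inj₂ refl        = refl
    meetsC : ∀ e → MeetsFibre (swap B p g) e
    meetsC e with meets e
    ... | f , f∈B , tf≡te with f ≟ p
    ...   | yes refl = g , ∈-swap-new , trans tg≡tp tf≡te
    ...   | no f≢p   = f , ∈-swap⁺ f∈B f≢p , tf≡te

  transversal-exchange : ∀ {A B} → IsTransversal A → IsTransversal B → A <ₗₑₓ B →
    ∃[ C ] ∃[ e ] (IsTransversal C × C <ₗₑₓ B × e ∈ B × A ∩ B ⊆ C ∩ B × C ∩ B ≡ B - e)
  transversal-exchange {A} {B} (_ , meetsA) transB@(injB , _) A<B
    with <ₗₑₓ⇒firstDifference A<B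
  ... | p , p∉A , p∈B , agree with meetsA p
  ... | g , g∈A , tg≡tp =
    swap B p g , p , swap-isTransversal transB p∈B tg≡tp , swap-<ₗₑₓ p∈B p<g , p∈B
    , swap-∩-⊇ p∉A , swap-∩ g∉B
    where
    g∉B : g ∉ B
    g∉B g∈B = p∉A (subst (_∈ A) (injB g p g∈B p∈B tg≡tp) g∈A)
    p<g : p < g
    p<g with <-cmp p g
    ... | tri< p<g _ _ = p<g
    ... | tri≈ _ refl _ = contradiction g∈A p∉A
    ... | tri> _ _ g<p = contradiction (to (agree g<p) g∈A) g∉B

  transversals : List (Subset m)
  transversals = filter isTransversal? (subsets m)

  transversals-sorted : AllPairs _<ₗₑₓ_ transversals
  transversals-sorted = AllPairs.filter⁺ isTransversal? (subsets-sorted m)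

  transversal : Fin (length transversals) → Subset m
  transversal = lookup transversals

  transversal-isTransversal : ∀ i → IsTransversal (transversal i)
  transversal-isTransversal i = proj₂ (∈-filter⁻ isTransversal? {xs = subsets m} (∈-lookup i))

  transversal-surjective : ∀ {S} → IsTransversal S → ∃[ i ] transversal i ≡ S
  transversal-surjective {S} transS = index S∈ , sym (lookup-index S∈)
    where S∈ = ∈-filter⁺ isTransversal? (∈-subsets S) transS

  transversal-shelling : ∀ i k → i < k →
    ∃[ j ] ∃[ e ] (j < k × e ∈ transversal k
      × transversal i ∩ transversal k ⊆ transversal j ∩ transversal k
      × transversal j ∩ transversal k ≡ transversal k - e)
  transversal-shelling i k i<k
    with transversal-exchange (transversal-isTransversal i) (transversal-isTransversal k)
           (lookup-strictMono transversals-sorted i<k)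
  ... | C , e , transC , C<k , rest with transversal-surjective transC
  ... | j , refl = j , e , lookup-reflects transversals-sorted <ₗₑₓ-asym C<k , rest

Walk-mono : ∀ {G S T e e'} → S ⊆ T → Walk G S e e' → Walk G T e e'
Walk-mono S⊆T (single e∈S)     = single (S⊆T e∈S)
Walk-mono S⊆T (step e∈S eq w) = step (S⊆T e∈S) eq (Walk-mono S⊆T w)

IsDAG⇒acyclic : ∀ {G} → IsDAG G → ∀ S → ¬ HasDirectedCycle G S
IsDAG⇒acyclic dag S (e , e' , w , closed) = dag (e , e' , Walk-mono (λ _ → ∈⊤) w , closed)

module _ {G : Digraph} (dag : IsDAG G) where
  open Transversals (tgt G)

  transversal⇒facet : ∀ {S} → IsTransversal S → IsFacetDT G S
  transversal⇒facet {S} (inj , meets) = (inj , IsDAG⇒acyclic dag S) , maximal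
    where
    maximal : ∀ F → IsDirectedForest G F → ¬ (S ⊂ F)
    maximal F (injF , _) (S⊆F , x , x∈F , x∉S) with meets x
    ... | f , f∈S , tf≡tx = x∉S (subst (_∈ S) (injF f x (S⊆F f∈S) x∈F tf≡tx) f∈S)

  facet⇒transversal : ∀ {S} → IsFacetDT G S → IsTransversal S
  facet⇒transversal {S} ((inj , _) , maximal) = inj , meets
    where
    meets : ∀ e → MeetsFibre S e
    meets e with meetsFibre? S e
    ... | yes meets-e = meets-e
    ... | no ¬meets-e =
      contradiction S⊂S∪e (maximal (S ∪ ⁅ e ⁆) (injectiveOn-∪-⁅⁆ inj ¬meets-e , IsDAG⇒acyclic dag _))
      where
      S⊂S∪e : S ⊂ S ∪ ⁅ e ⁆
      S⊂S∪e = p⊆p∪q ⁅ e ⁆ , e , x∈p∪q⁺ (inj₂ (x∈⁅x⁆ e)) , λ e∈S → ¬meets-e (e , e∈S , refl)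

corollary2p10 : (G : Digraph) → IsDAG G → DTShellable G
corollary2p10 G dag =
  length transversals , transversal
  , lookup-injective transversals-sorted <ₗₑₓ-asym
  , (λ i → transversal⇒facet dag (transversal-isTransversal i))
  , (λ X X-facet → transversal-surjective (facet⇒transversal dag X-facet))
  , transversal-shelling
  where open Transversals (tgt G)
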